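{- Let $G$ be an outerplanar graph embedded in the plane whose outer face is bounded by a cycle $C$ through all vertices of $G$, and let $\mathcal{H},\mathcal{K}$ be non-piercing families of subgraphs of $G$. Then the cycle intersection system $(C,\mathcal{H},\mathcal{K})$ (each member viewed as its vertex set on $C$) satisfies the strong $axax$-free property.
   Context: A family of connected subgraphs of $G$ is non-piercing if for any two members $H,H'$ the subgraph of $G$ induced on $V(H)\setminus V(H')$ is connected. A family $\mathcal{F}$ of vertex subsets of $C$ is $axax$-free if there are no $F,F'\in\mathcal{F}$ and four distinct vertices $a_1,x_1,a_2,x_2$ in this cyclic order on $C$ with $a_1,a_2\in F\setminus F'$ and $x_1,x_2\in F'$. $(C,\mathcal{H},\mathcal{K})$ satisfies the intersection property if for any $H\in\mathcal{H}$, $K\in\mathcal{K}$ and vertices $h_1,k_1,h_2,k_2$ in cyclic order on $C$ with $h_1,h_2\in H$, $k_1,k_2\in K$, we have $H\cap K\neq\emptyset$. It is strong $axax$-free if $\mathcal{H}$ and $\mathcal{K}$ are both $axax$-free and the intersection property holds. -}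

module Defs where

open import Data.Nat using (ℕ; zero; suc; _<_; _≤_)
open import Data.Fin using (Fin; toℕ)
open import Data.Product using (_×_; ∃)
open import Data.Sum using (_⊎_)
open import Data.Empty using (⊥)
open import Relation.Nullary using (¬_)
open import Relation.Binary.PropositionalEquality using (_≡_)

-- Vertices of G are Fin n, numbered 0,1,…,n-1 along the cycle C.

Cyc4 : ∀ {n} → Fin n → Fin n → Fin n → Fin n → Set
Cyc4 a b c d =
    (toℕ a < toℕ b × toℕ b < toℕ c × toℕ c < toℕ d)
  ⊎ (toℕ b < toℕ c × toℕ c < toℕ d × toℕ d < toℕ a)
  ⊎ (toℕ c < toℕ d × toℕ d < toℕ a × toℕ a < toℕ b)
  ⊎ (toℕ d < toℕ a × toℕ a < toℕ b × toℕ b < toℕ c)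

CycleStep : ∀ {n} → Fin (suc n) → Fin (suc n) → Set
CycleStep {n} i j = (toℕ j ≡ suc (toℕ i)) ⊎ (toℕ i ≡ n × toℕ j ≡ 0)

record Graph (n : ℕ) : Set₁ where
  field
    Adj   : Fin n → Fin n → Set
    sym   : ∀ {u v} → Adj u v → Adj v u
    irref : ∀ {u} → ¬ Adj u u

-- G (on at least 3 vertices) is outerplanar, embedded with outer face
-- bounded by the Hamiltonian cycle C = 0,1,…,n-1,0: G contains all edges
-- of C, and no two edges of G cross with respect to the cyclic order of C.
record OuterplanarHam (n : ℕ) (G : Graph (suc n)) : Set where
  open Graph G
  field
    three     : 2 ≤ n
    cycle     : ∀ i j → CycleStep i j → Adj i j
    noCrossing : ∀ a b c d → Adj a c → Adj b d → ¬ Cyc4 a b c d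

data Reach {n} (E : Fin n → Fin n → Set) (S : Fin n → Set) : Fin n → Fin n → Set where
  here : ∀ {u} → S u → Reach E S u u
  step : ∀ {u w v} → Reach E S u w → E w v → S v → Reach E S u v

InducedConnected : ∀ {n} → Graph n → (Fin n → Set) → Set
InducedConnected G S = ∀ u v → S u → S v → Reach (Graph.Adj G) S u v

record Subgraph {n} (G : Graph n) : Set₁ where
  field
    V     : Fin n → Set
    E     : Fin n → Fin n → Set
    E⊆G   : ∀ {u v} → E u v → Graph.Adj G u v
    E-end : ∀ {u v} → E u v → V u × V v

Connected : ∀ {n} {G : Graph n} → Subgraph G → Set
Connected H = ∀ u v → V u → V v → Reach E V u v
  where open Subgraph H

NonPiercing : ∀ {n} (G : Graph n) {I : Set} → (I → Subgraph G) → Set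
NonPiercing G H =
    (∀ i → Connected (H i))
  × (∀ i j → InducedConnected G (λ v → Subgraph.V (H i) v × ¬ Subgraph.V (H j) v))

AxaxFree : ∀ {n} {I : Set} → (I → Fin n → Set) → Set
AxaxFree {n} {I} F = ∀ (i j : I) (a₁ x₁ a₂ x₂ : Fin n) → Cyc4 a₁ x₁ a₂ x₂ →
  F i a₁ → ¬ F j a₁ → F i a₂ → ¬ F j a₂ → F j x₁ → F j x₂ → ⊥

IntersectionProperty : ∀ {n} {I J : Set} → (I → Fin n → Set) → (J → Fin n → Set) → Set
IntersectionProperty {n} {I} {J} H K = ∀ (i : I) (j : J) (h₁ k₁ h₂ k₂ : Fin n) →
  Cyc4 h₁ k₁ h₂ k₂ → H i h₁ → H i h₂ → K j k₁ → K j k₂ → ∃ λ v → H i v × K j v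

StrongAxaxFree : ∀ {n} {I J : Set} → (I → Fin n → Set) → (J → Fin n → Set) → Set
StrongAxaxFree H K = AxaxFree H × AxaxFree K × IntersectionProperty H K

-- Two walks whose endpoints alternate around C must meet: the walk from b to d
-- has to leave one arc of C cut off by {a, c} for the other, so it either
-- visits a or c, or uses an edge yz separating a from c; since edges of G do
-- not cross, the walk from a to c must then visit y or z. The axax-freeness
-- of a non-piercing family applies this to a walk in H ∖ H′ between a₁, a₂
-- and a walk in H′ between x₁, x₂; the intersection property applies it to
-- walks in H and in K.
module Submission where

open import Data.Nat using (ℕ; suc)
open import Data.Fin using (Fin; _<_)
open import Data.Fin.Properties using (<-cmp; <-trans; <-asym; <⇒≢)
open import Data.Product using (_×_; _,_; ∃; ∃₂; proj₁)
open import Data.Sum using (_⊎_; inj₁; inj₂; swap)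
open import Data.Empty using (⊥-elim)
open import Relation.Nullary using (¬_)
open import Relation.Binary using (tri<; tri≈; tri>)
open import Relation.Binary.PropositionalEquality using (_≡_; _≢_; refl; sym)
open import Defs

private
  variable
    n : ℕ
    a b c d x : Fin n

Cyc3 : Fin n → Fin n → Fin n → Set
Cyc3 a b c = (a < b × b < c) ⊎ (b < c × c < a) ⊎ (c < a × a < b)

Cyc3⇒≢ : Cyc3 a b c → a ≢ c
Cyc3⇒≢ (inj₁ (ab , bc))        = <⇒≢ (<-trans ab bc)
Cyc3⇒≢ (inj₂ (inj₁ (_ , ca)))  = λ a≡c → <⇒≢ ca (sym a≡c)
Cyc3⇒≢ (inj₂ (inj₂ (ca , _)))  = λ a≡c → <⇒≢ ca (sym a≡c)

Cyc3-disjoint : Cyc3 a x c → ¬ Cyc3 c x a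
Cyc3-disjoint (inj₁ (ax , _))        (inj₁ (_ , xa))        = <-asym ax xa
Cyc3-disjoint (inj₁ (ax , _))        (inj₂ (inj₁ (xa , _))) = <-asym ax xa
Cyc3-disjoint (inj₁ (_ , xc))        (inj₂ (inj₂ (_ , cx))) = <-asym xc cx
Cyc3-disjoint (inj₂ (inj₁ (xc , _))) (inj₁ (cx , _))        = <-asym xc cx
Cyc3-disjoint (inj₂ (inj₁ (_ , ca))) (inj₂ (inj₁ (_ , ac))) = <-asym ca ac
Cyc3-disjoint (inj₂ (inj₁ (_ , ca))) (inj₂ (inj₂ (ac , _))) = <-asym ca ac
Cyc3-disjoint (inj₂ (inj₂ (_ , ax))) (inj₁ (_ , xa))        = <-asym ax xa
Cyc3-disjoint (inj₂ (inj₂ (ca , _))) (inj₂ (inj₁ (_ , ac))) = <-asym ca ac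
Cyc3-disjoint (inj₂ (inj₂ (ca , _))) (inj₂ (inj₂ (ac , _))) = <-asym ca ac

Cyc3-trichotomy-< : a < c → ∀ x → (x ≡ a ⊎ x ≡ c) ⊎ Cyc3 a x c ⊎ Cyc3 c x a
Cyc3-trichotomy-< {a = a} {c = c} ac x with <-cmp x a
... | tri< xa _ _ = inj₂ (inj₂ (inj₂ (inj₁ (xa , ac))))
... | tri≈ _ x≡a _ = inj₁ (inj₁ x≡a)
... | tri> _ _ ax with <-cmp x c
...   | tri< xc _ _ = inj₂ (inj₁ (inj₁ (ax , xc)))
...   | tri≈ _ x≡c _ = inj₁ (inj₂ x≡c)
...   | tri> _ _ cx = inj₂ (inj₂ (inj₂ (inj₂ (ac , cx))))

Cyc3-trichotomy : a ≢ c → ∀ x → (x ≡ a ⊎ x ≡ c) ⊎ Cyc3 a x c ⊎ Cyc3 c x a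
Cyc3-trichotomy {a = a} {c = c} a≢c x with <-cmp a c
... | tri< ac _ _  = Cyc3-trichotomy-< ac x
... | tri≈ _ a≡c _ = ⊥-elim (a≢c a≡c)
... | tri> _ _ ca with Cyc3-trichotomy-< ca x
...   | inj₁ x∈ca = inj₁ (swap x∈ca)
...   | inj₂ x∈arc = inj₂ (swap x∈arc)

Cyc4⇒Cyc3 : Cyc4 a b c d → Cyc3 a b c × Cyc3 c d a
Cyc4⇒Cyc3 (inj₁ (ab , bc , cd))               = inj₁ (ab , bc) , inj₂ (inj₂ (<-trans ab bc , cd))
Cyc4⇒Cyc3 (inj₂ (inj₁ (bc , cd , da)))        = inj₂ (inj₁ (bc , <-trans cd da)) , inj₁ (cd , da)
Cyc4⇒Cyc3 (inj₂ (inj₂ (inj₁ (cd , da , ab)))) = inj₂ (inj₂ (<-trans cd da , ab)) , inj₁ (cd , da)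
Cyc4⇒Cyc3 (inj₂ (inj₂ (inj₂ (da , ab , bc)))) = inj₁ (ab , bc) , inj₂ (inj₁ (da , <-trans ab bc))

Cyc3⇒Cyc4 : Cyc3 a b c → Cyc3 c d a → Cyc4 a b c d
Cyc3⇒Cyc4 (inj₁ (ab , bc))        (inj₁ (cd , da))        = ⊥-elim (<-asym (<-trans ab bc) (<-trans cd da))
Cyc3⇒Cyc4 (inj₁ (ab , bc))        (inj₂ (inj₁ (da , _)))  = inj₂ (inj₂ (inj₂ (da , ab , bc)))
Cyc3⇒Cyc4 (inj₁ (ab , bc))        (inj₂ (inj₂ (_ , cd)))  = inj₁ (ab , bc , cd)
Cyc3⇒Cyc4 (inj₂ (inj₁ (bc , _)))  (inj₁ (cd , da))        = inj₂ (inj₁ (bc , cd , da))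
Cyc3⇒Cyc4 (inj₂ (inj₁ (_ , ca)))  (inj₂ (inj₁ (_ , ac)))  = ⊥-elim (<-asym ca ac)
Cyc3⇒Cyc4 (inj₂ (inj₁ (_ , ca)))  (inj₂ (inj₂ (ac , _)))  = ⊥-elim (<-asym ca ac)
Cyc3⇒Cyc4 (inj₂ (inj₂ (_ , ab)))  (inj₁ (cd , da))        = inj₂ (inj₂ (inj₁ (cd , da , ab)))
Cyc3⇒Cyc4 (inj₂ (inj₂ (ca , _)))  (inj₂ (inj₁ (_ , ac)))  = ⊥-elim (<-asym ca ac)
Cyc3⇒Cyc4 (inj₂ (inj₂ (ca , _)))  (inj₂ (inj₂ (ac , _)))  = ⊥-elim (<-asym ca ac)

Cyc4-rotate : Cyc4 a b c d → Cyc4 d a b c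
Cyc4-rotate (inj₁ abcd)               = inj₂ (inj₁ abcd)
Cyc4-rotate (inj₂ (inj₁ bcda))        = inj₂ (inj₂ (inj₁ bcda))
Cyc4-rotate (inj₂ (inj₂ (inj₁ cdab))) = inj₂ (inj₂ (inj₂ cdab))
Cyc4-rotate (inj₂ (inj₂ (inj₂ dabc))) = inj₁ dabc

module _ {E : Fin n → Fin n → Set} {S : Fin n → Set} where

  Reach-start : Reach E S a b → S a
  Reach-start (here Sa)       = Sa
  Reach-start (step walk _ _) = Reach-start walk

  Reach-end : Reach E S a b → S b
  Reach-end (here Sb)     = Sb
  Reach-end (step _ _ Sb) = Sb

  Reach-map : {E′ : Fin n → Fin n → Set} → (∀ {u v} → E u v → E′ u v) →
              Reach E S a b → Reach E′ S a b
  Reach-map f (here Sa)        = here Sa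
  Reach-map f (step walk e Sb) = step (Reach-map f walk) (f e) Sb

  Reach-exit : {Bd In Out : Fin n → Set} →
               (∀ x → Bd x ⊎ In x ⊎ Out x) → (∀ {x} → In x → ¬ Out x) →
               Reach E S a b → In a → Out b →
               (∃ λ x → Bd x × S x) ⊎ (∃₂ λ y z → E y z × In y × Out z × S y × S z)
  Reach-exit cover disjoint (here _) In-a Out-a = ⊥-elim (disjoint In-a Out-a)
  Reach-exit cover disjoint (step {w = w} walk e Sb) In-a Out-b with cover w
  ... | inj₁ Bd-w         = inj₁ (w , Bd-w , Reach-end walk)
  ... | inj₂ (inj₁ In-w)  = inj₂ (w , _ , e , In-w , Out-b , Reach-end walk , Sb)
  ... | inj₂ (inj₂ Out-w) = Reach-exit cover disjoint walk In-a Out-w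

module NonCrossing (G : Graph n)
  (noCrossing : ∀ a b c d → Graph.Adj G a c → Graph.Adj G b d → ¬ Cyc4 a b c d) where
  open Graph G using (Adj) renaming (sym to Adj-sym)

  Reach-crosses-chord : {S : Fin n → Set} → Reach Adj S b d → Cyc4 a b c d →
    (S a ⊎ S c) ⊎ (∃₂ λ y z → Adj y z × S y × S z × Cyc4 a y c z)
  Reach-crosses-chord walk cyc with Cyc4⇒Cyc3 cyc
  ... | abc , cda with Reach-exit (Cyc3-trichotomy (Cyc3⇒≢ abc)) Cyc3-disjoint walk abc cda
  ...   | inj₁ (_ , inj₁ refl , Sa) = inj₁ (inj₁ Sa)
  ...   | inj₁ (_ , inj₂ refl , Sc) = inj₁ (inj₂ Sc)
  ...   | inj₂ (y , z , e , ayc , cza , Sy , Sz) = inj₂ (y , z , e , Sy , Sz , Cyc3⇒Cyc4 ayc cza)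

  Reach-meet : {S T : Fin n → Set} → Reach Adj S a c → Reach Adj T b d → Cyc4 a b c d →
               ∃ λ v → S v × T v
  Reach-meet {a = a} {c = c} P Q cyc with Reach-crosses-chord Q cyc
  ... | inj₁ (inj₁ Ta) = a , Reach-start P , Ta
  ... | inj₁ (inj₂ Tc) = c , Reach-end P , Tc
  ... | inj₂ (y , z , yz , Ty , Tz , aycz) with Reach-crosses-chord P (Cyc4-rotate aycz)
  ...   | inj₁ (inj₁ Sz) = z , Sz , Tz
  ...   | inj₁ (inj₂ Sy) = y , Sy , Ty
  ...   | inj₂ (y′ , z′ , y′z′ , _ , _ , zy′yz′) = ⊥-elim (noCrossing _ _ _ _ (Adj-sym yz) y′z′ zy′yz′)

  Connected⇒Reach : (H : Subgraph G) → Connected H → ∀ {u v} →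
                    Subgraph.V H u → Subgraph.V H v → Reach Adj (Subgraph.V H) u v
  Connected⇒Reach H connected Hu Hv = Reach-map (Subgraph.E⊆G H) (connected _ _ Hu Hv)

  nonPiercing⇒axaxFree : {I : Set} (F : I → Subgraph G) → NonPiercing G F →
                         AxaxFree (λ i → Subgraph.V (F i))
  nonPiercing⇒axaxFree F (connected , differenceConnected)
                       i j a₁ x₁ a₂ x₂ cyc Fa₁ ¬F′a₁ Fa₂ ¬F′a₂ F′x₁ F′x₂
    with Reach-meet (differenceConnected i j a₁ a₂ (Fa₁ , ¬F′a₁) (Fa₂ , ¬F′a₂))
                    (Connected⇒Reach (F j) (connected j) F′x₁ F′x₂) cyc
  ... | _ , (_ , ¬F′v) , F′v = ¬F′v F′v

  connected⇒intersectionProperty : {I J : Set} (H : I → Subgraph G) (K : J → Subgraph G) →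
    (∀ i → Connected (H i)) → (∀ j → Connected (K j)) →
    IntersectionProperty (λ i → Subgraph.V (H i)) (λ j → Subgraph.V (K j))
  connected⇒intersectionProperty H K H-connected K-connected
                                 i j h₁ k₁ h₂ k₂ cyc Hh₁ Hh₂ Kk₁ Kk₂ =
    Reach-meet (Connected⇒Reach (H i) (H-connected i) Hh₁ Hh₂)
               (Connected⇒Reach (K j) (K-connected j) Kk₁ Kk₂) cyc

lemma9 : (n : ℕ) (G : Graph (suc n)) → OuterplanarHam n G →
    {I J : Set} (H : I → Subgraph G) (K : J → Subgraph G) →
    NonPiercing G H → NonPiercing G K →
    StrongAxaxFree (λ i → Subgraph.V (H i)) (λ j → Subgraph.V (K j))
lemma9 n G outerplanar H K H-nonPiercing K-nonPiercing =
    nonPiercing⇒axaxFree H H-nonPiercing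
  , nonPiercing⇒axaxFree K K-nonPiercing
  , connected⇒intersectionProperty H K (proj₁ H-nonPiercing) (proj₁ K-nonPiercing)
  where open NonCrossing G (OuterplanarHam.noCrossing outerplanar)
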